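{- Let $n=n_1+\cdots+n_r$ with $r\ge1$ and positive integers $n_i$, $N_0=0$, $N_i=n_1+\cdots+n_i$, $b_1,\dots,b_n$ positive integers, and $\Delta\subset\mathbb{R}^{n+1}$ the convex hull of $V_0,\dots,V_{n+r+1}$ as in the context. Let $\delta$ be a codimension $1$ face of $\Delta$ not containing the origin whose vertex set is $\{V_{n+1}\}\cup(\{V_1,\dots,V_n\}\setminus\{V_{i_1},\dots,V_{i_k}\})\cup\{V_{n+1+j_1},\dots,V_{n+1+j_k}\}$, where $0\le k\le r$, $j_1,\dots,j_k\in\{1,\dots,r\}$ are pairwise distinct and $N_{j_l-1}+1\le i_l\le N_{j_l}$. Then the affine hyperplane containing $\delta$ has equation $\sum_{m=1}^{n+1}c_mx_m=1$, where $$c_m=\begin{cases}1 & \text{if } m\notin\{i_1,\dots,i_k\},\\[2pt] -\dfrac{1}{b_{i_l}}\Bigl(\sum_{t=N_{j_l-1}+1}^{N_{j_l}}b_t-b_{i_l}\Bigr) & \text{if } m=i_l.\end{cases}$$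
   Context: $V_0=0$; $V_1,\dots,V_{n+1}$ are the standard basis vectors $e_1,\dots,e_{n+1}$ of $\mathbb{R}^{n+1}$; and for $1\le i\le r$, $V_{n+1+i}=e_{n+1}-\sum_{l=N_{i-1}+1}^{N_i}b_le_l$.
   Formalization: The polytope Δ and its face δ are taken in ℚ^(n+1) instead of ℝ^(n+1), and the supporting hyperplane cutting out δ has rational coefficients. -}

module Defs where

open import Data.Nat as ℕ using (ℕ; zero; suc; _∸_; _≟_; _≤?_; _<?_)
open import Data.Integer as ℤ using (ℤ; +_)
open import Data.Rational as ℚ using (ℚ; 0ℚ; 1ℚ; _/_)
open import Data.Product using (Σ; _×_; ∃)
open import Data.Sum using (_⊎_)
open import Data.Bool using (if_then_else_)
open import Relation.Nullary using (¬_; does)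
open import Relation.Nullary.Decidable using (_×-dec_)
open import Relation.Binary.PropositionalEquality using (_≡_; _≢_)

sumR : (ℕ → ℕ) → ℕ → ℕ → ℕ
sumR f a zero    = 0
sumR f a (suc k) = f a ℕ.+ sumR f (suc a) k

sumQ : (ℕ → ℚ) → ℕ → ℕ → ℚ
sumQ f a zero    = 0ℚ
sumQ f a (suc k) = f a ℚ.+ sumQ f (suc a) k

N : (ℕ → ℕ) → ℕ → ℕ
N ns i = sumR ns 1 i

-- a point of ℝ^{n+1} (here ℚ^{n+1}): coordinates 1..n+1 of a function ℕ → ℚ
Pt : Set
Pt = ℕ → ℚ

-- the fraction a / d, for d positive (value for d = 0 is an irrelevant dummy)
frac : ℤ → ℕ → ℚ
frac a zero    = 0ℚ
frac a (suc d) = a / suc d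

ℕ→ℚ : ℕ → ℚ
ℕ→ℚ m = (+ m) / 1

-- Vertices V_0, ..., V_{n+r+1} of Δ ⊂ ℚ^{n+1}, with n = N ns r.
-- V_0 = 0, V_q = e_q (1 ≤ q ≤ n+1),
-- V_{n+1+i} = e_{n+1} - Σ_{l = N_{i-1}+1}^{N_i} b_l e_l.
V : (r : ℕ) (ns b : ℕ → ℕ) → ℕ → Pt
V r ns b q m =
  let n = N ns r in
  if does (q ≟ 0) then 0ℚ
  else if does (q ≤? suc n) then (if does (m ≟ q) then 1ℚ else 0ℚ)
  else (let i = q ∸ suc n in
        if does (m ≟ suc n) then 1ℚ
        else if does ((N ns (i ∸ 1) <? m) ×-dec (m ≤? N ns i))
             then ℚ.- ℕ→ℚ (b m) else 0ℚ)

dot : ℕ → Pt → Pt → ℚ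
dot d c x = sumQ (λ m → c m ℚ.* x m) 1 d

_≐[_]_ : Pt → ℕ → Pt → Set
x ≐[ d ] y = ∀ m → 1 ℕ.≤ m → m ℕ.≤ d → x m ≡ y m

InΔ : (r : ℕ) (ns b : ℕ → ℕ) → Pt → Set
InΔ r ns b x =
  let n = N ns r in
  Σ (ℕ → ℚ) λ w →
    (∀ q → q ℕ.≤ n ℕ.+ r ℕ.+ 1 → 0ℚ ℚ.≤ w q) ×
    (sumQ w 0 (n ℕ.+ r ℕ.+ 2) ≡ 1ℚ) ×
    (x ≐[ suc n ] (λ m → sumQ (λ q → w q ℚ.* V r ns b q m) 0 (n ℕ.+ r ℕ.+ 2)))

InFace : (r : ℕ) (ns b : ℕ → ℕ) → Pt → ℚ → Pt → Set
InFace r ns b a β x = InΔ r ns b x × (dot (suc (N ns r)) a x ≡ β)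

IsExtreme : ℕ → (Pt → Set) → Pt → Set
IsExtreme d P x =
  P x × (∀ y z t → P y → P z → 0ℚ ℚ.< t → t ℚ.< 1ℚ →
         x ≐[ d ] (λ m → t ℚ.* y m ℚ.+ (1ℚ ℚ.- t) ℚ.* z m) → y ≐[ d ] z)

AffInd : ℕ → (ℕ → Pt) → ℕ → Set
AffInd d p s =
  ∀ (λs : ℕ → ℚ) → sumQ λs 0 (suc s) ≡ 0ℚ →
    (λ m → sumQ (λ t → λs t ℚ.* p t m) 0 (suc s)) ≐[ d ] (λ _ → 0ℚ) →
    ∀ t → t ℕ.≤ s → λs t ≡ 0ℚ

-- (a, β) defines a codimension 1 face of Δ (a supporting hyperplane meeting Δ
-- in a set of affine dimension n)
IsFacet : (r : ℕ) (ns b : ℕ → ℕ) → Pt → ℚ → Set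
IsFacet r ns b a β =
  let n = N ns r in
  (∃ λ m → 1 ℕ.≤ m × m ℕ.≤ suc n × a m ≢ 0ℚ) ×
  (∀ x → InΔ r ns b x → dot (suc n) a x ℚ.≤ β) ×
  (Σ (ℕ → Pt) λ p → (∀ t → t ℕ.≤ n → InFace r ns b a β (p t)) × AffInd (suc n) p n)

InS : (r : ℕ) (ns : ℕ → ℕ) (k : ℕ) (i j : ℕ → ℕ) → ℕ → Set
InS r ns k i j q =
  let n = N ns r in
  (q ≡ suc n) ⊎
  ((1 ℕ.≤ q × q ℕ.≤ n × (∀ l → 1 ℕ.≤ l → l ℕ.≤ k → q ≢ i l)) ⊎
   (∃ λ l → 1 ℕ.≤ l × l ℕ.≤ k × q ≡ suc n ℕ.+ j l))

-- Write x in the face as a convex combination of the vertices of Δ. Since a·y ≤ β on Δ with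
-- equality at x, only vertices lying on the face carry weight. Every vertex of Δ other than the
-- origin strictly maximises some linear functional over Δ, so such a vertex is an extreme point
-- of the face and hence one of the listed vertices of δ. On those, c·V = 1 by direct computation:
-- at V_{n+1+j_l} the coefficient c_{i_l} exactly cancels the sum over block j_l. So c·x = 1.

module Submission where

open import Defs
open import Data.Nat as ℕ using (ℕ; zero; suc; _∸_; z≤n; s≤s)
import Data.Nat.Properties as ℕP
open import Data.Integer as ℤ using (ℤ; +_)
import Data.Integer.Properties as ℤP
open import Data.Rational as ℚ using (ℚ; 0ℚ; 1ℚ; _/_)
import Data.Rational.Properties as ℚP
open import Data.Rational.Unnormalised as ℚᵘ using (mkℚᵘ; *≡*)
import Data.Rational.Unnormalised.Properties as ℚᵘP
open import Data.Rational.Solver using (module +-*-Solver)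
open import Data.Product using (Σ; _×_; ∃; _,_; proj₁; proj₂)
open import Data.Sum as Sum using (_⊎_; inj₁; inj₂; [_,_]′)
open import Data.Empty using (⊥-elim)
open import Data.Bool using (if_then_else_)
open import Relation.Nullary using (¬_; Dec; yes; no; does)
open import Relation.Nullary.Decidable using (_×-dec_)
open import Relation.Binary.PropositionalEquality
open import Relation.Binary.Definitions using (tri<; tri≈; tri>)
open import Function.Base using (id)
open import Function.Bundles using (_⇔_; Equivalence)
open +-*-Solver

if-yes : ∀ {P : Set} {A : Set} {x y : A} (p? : Dec P) → P → (if does p? then x else y) ≡ x
if-yes (yes _) _ = refl
if-yes (no ¬p) p = ⊥-elim (¬p p)

if-no : ∀ {P : Set} {A : Set} {x y : A} (p? : Dec P) → ¬ P → (if does p? then x else y) ≡ y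
if-no (yes p) ¬p = ⊥-elim (¬p p)
if-no (no _) _ = refl

if-elim : ∀ {P : Set} {A : Set} (R : A → Set) {x y : A} (p? : Dec P) → R x → R y → R (if does p? then x else y)
if-elim R (yes _) Rx Ry = Rx
if-elim R (no _)  Rx Ry = Ry

-- Rational numbers

fromℤ : ℤ → ℚ
fromℤ z = z / 1

toℚᵘ-fromℤ : ∀ z → ℚ.toℚᵘ (fromℤ z) ℚᵘ.≃ mkℚᵘ z 0
toℚᵘ-fromℤ z = ℚP.toℚᵘ-fromℚᵘ (mkℚᵘ z 0)

fromℤ-homo-+ : ∀ z w → fromℤ (z ℤ.+ w) ≡ fromℤ z ℚ.+ fromℤ w
fromℤ-homo-+ z w = ℚP.toℚᵘ-injective (begin
    ℚ.toℚᵘ (fromℤ (z ℤ.+ w))             ≈⟨ toℚᵘ-fromℤ (z ℤ.+ w) ⟩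
    mkℚᵘ (z ℤ.+ w) 0                      ≈⟨ *≡* numerators ⟩
    mkℚᵘ z 0 ℚᵘ.+ mkℚᵘ w 0                ≈⟨ ℚᵘP.+-cong (ℚᵘP.≃-sym (toℚᵘ-fromℤ z)) (ℚᵘP.≃-sym (toℚᵘ-fromℤ w)) ⟩
    ℚ.toℚᵘ (fromℤ z) ℚᵘ.+ ℚ.toℚᵘ (fromℤ w) ≈⟨ ℚᵘP.≃-sym (ℚP.toℚᵘ-homo-+ (fromℤ z) (fromℤ w)) ⟩
    ℚ.toℚᵘ (fromℤ z ℚ.+ fromℤ w)           ∎)
  where
  open ℚᵘP.≃-Reasoning
  numerators : (z ℤ.+ w) ℤ.* + 1 ≡ (z ℤ.* + 1 ℤ.+ w ℤ.* + 1) ℤ.* + 1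
  numerators rewrite ℤP.*-identityʳ z | ℤP.*-identityʳ w | ℤP.*-identityʳ (z ℤ.+ w) = refl

fromℤ-homo-neg : ∀ z → fromℤ (ℤ.- z) ≡ ℚ.- fromℤ z
fromℤ-homo-neg z = ℚP.toℚᵘ-injective (begin
    ℚ.toℚᵘ (fromℤ (ℤ.- z)) ≈⟨ toℚᵘ-fromℤ (ℤ.- z) ⟩
    mkℚᵘ (ℤ.- z) 0          ≈⟨ *≡* refl ⟩
    ℚᵘ.- mkℚᵘ z 0           ≈⟨ ℚᵘP.-‿cong (ℚᵘP.≃-sym (toℚᵘ-fromℤ z)) ⟩
    ℚᵘ.- ℚ.toℚᵘ (fromℤ z)   ≈⟨ ℚᵘP.≃-sym (ℚP.toℚᵘ-homo‿- (fromℤ z)) ⟩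
    ℚ.toℚᵘ (ℚ.- fromℤ z)    ∎)
  where open ℚᵘP.≃-Reasoning

fromℤ-homo-- : ∀ z w → fromℤ (z ℤ.- w) ≡ fromℤ z ℚ.- fromℤ w
fromℤ-homo-- z w = trans (fromℤ-homo-+ z (ℤ.- w)) (cong (fromℤ z ℚ.+_) (fromℤ-homo-neg w))

frac-*-denominator : ∀ z d → 1 ℕ.≤ d → frac z d ℚ.* ℕ→ℚ d ≡ fromℤ z
frac-*-denominator z (suc d) _ = ℚP.toℚᵘ-injective (begin
    ℚ.toℚᵘ ((z / suc d) ℚ.* ℕ→ℚ (suc d))          ≈⟨ ℚP.toℚᵘ-homo-* (z / suc d) (ℕ→ℚ (suc d)) ⟩
    ℚ.toℚᵘ (z / suc d) ℚᵘ.* ℚ.toℚᵘ (ℕ→ℚ (suc d)) ≈⟨ ℚᵘP.*-cong (ℚP.toℚᵘ-fromℚᵘ (mkℚᵘ z d)) (toℚᵘ-fromℤ (+ suc d)) ⟩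
    mkℚᵘ z d ℚᵘ.* mkℚᵘ (+ suc d) 0                 ≈⟨ *≡* cross ⟩
    mkℚᵘ z 0                                       ≈⟨ ℚᵘP.≃-sym (toℚᵘ-fromℤ z) ⟩
    ℚ.toℚᵘ (fromℤ z)                               ∎)
  where
  open ℚᵘP.≃-Reasoning
  cross : z ℤ.* + suc d ℤ.* + 1 ≡ z ℤ.* + suc (d ℕ.* 1)
  cross = trans (ℤP.*-identityʳ _) (cong (λ e → z ℤ.* + suc e) (sym (ℕP.*-identityʳ d)))

ℕ→ℚ-homo-+ : ∀ x y → ℕ→ℚ (x ℕ.+ y) ≡ ℕ→ℚ x ℚ.+ ℕ→ℚ y
ℕ→ℚ-homo-+ x y = fromℤ-homo-+ (+ x) (+ y)

ℕ→ℚ-nonNeg : ∀ m → 0ℚ ℚ.≤ ℕ→ℚ m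
ℕ→ℚ-nonNeg m = ℚP.nonNegative⁻¹ (ℕ→ℚ m) {{ℚP.normalize-nonNeg m 1}}

ℕ→ℚ-pos : ∀ m → 1 ℕ.≤ m → 0ℚ ℚ.< ℕ→ℚ m
ℕ→ℚ-pos (suc m) _ = ℚP.positive⁻¹ (ℕ→ℚ (suc m)) {{ℚP.normalize-pos (suc m) 1}}

0<1 : 0ℚ ℚ.< 1ℚ
0<1 = ℚP.positive⁻¹ 1ℚ

*-nonNeg : ∀ {p q} → 0ℚ ℚ.≤ p → 0ℚ ℚ.≤ q → 0ℚ ℚ.≤ p ℚ.* q
*-nonNeg {p} {q} 0≤p 0≤q =
  ℚP.nonNegative⁻¹ _ {{ℚP.nonNeg*nonNeg⇒nonNeg p {{ℚ.nonNegative 0≤p}} q {{ℚ.nonNegative 0≤q}}}}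

p≤q⇒0≤q-p : ∀ {p q} → p ℚ.≤ q → 0ℚ ℚ.≤ q ℚ.- p
p≤q⇒0≤q-p {p} {q} p≤q = subst (ℚ._≤ q ℚ.- p) (ℚP.+-inverseʳ p) (ℚP.+-monoˡ-≤ (ℚ.- p) p≤q)

p<q⇒0<q-p : ∀ {p q} → p ℚ.< q → 0ℚ ℚ.< q ℚ.- p
p<q⇒0<q-p {p} {q} p<q = subst (ℚ._< q ℚ.- p) (ℚP.+-inverseʳ p) (ℚP.+-monoˡ-< (ℚ.- p) p<q)

p<p+q : ∀ p {q} → 0ℚ ℚ.< q → p ℚ.< p ℚ.+ q
p<p+q p {q} 0<q = subst (ℚ._< p ℚ.+ q) (ℚP.+-identityʳ p) (ℚP.+-monoʳ-< p 0<q)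

p-q<p : ∀ p {q} → 0ℚ ℚ.< q → p ℚ.- q ℚ.< p
p-q<p p {q} 0<q = subst (p ℚ.- q ℚ.<_) (ℚP.+-identityʳ p) (ℚP.+-monoʳ-< p (ℚP.neg-antimono-< 0<q))

p+[q-p]≡q : ∀ p q → p ℚ.+ (q ℚ.- p) ≡ q
p+[q-p]≡q = solve 2 (λ p q → p :+ (q :- p) := q) refl

0≤q-p⇒p≤q : ∀ {p q} → 0ℚ ℚ.≤ q ℚ.- p → p ℚ.≤ q
0≤q-p⇒p≤q {p} {q} 0≤q-p = subst₂ ℚ._≤_ (ℚP.+-identityʳ p) (p+[q-p]≡q p q) (ℚP.+-monoʳ-≤ p 0≤q-p)

q-p≡0⇒p≡q : ∀ {p q} → q ℚ.- p ≡ 0ℚ → p ≡ q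
q-p≡0⇒p≡q {p} {q} e = trans (sym (ℚP.+-identityʳ p)) (trans (cong (p ℚ.+_) (sym e)) (p+[q-p]≡q p q))

nonNeg+nonNeg≡0 : ∀ {p q} → 0ℚ ℚ.≤ p → 0ℚ ℚ.≤ q → p ℚ.+ q ≡ 0ℚ → p ≡ 0ℚ × q ≡ 0ℚ
nonNeg+nonNeg≡0 {p} {q} 0≤p 0≤q e = ℚP.≤-antisym (bound 0≤q e) 0≤p , ℚP.≤-antisym (bound 0≤p (trans (ℚP.+-comm q p) e)) 0≤q
  where
  bound : ∀ {x y} → 0ℚ ℚ.≤ y → x ℚ.+ y ≡ 0ℚ → x ℚ.≤ 0ℚ
  bound {x} 0≤y e′ = subst₂ ℚ._≤_ (ℚP.+-identityʳ x) e′ (ℚP.+-monoʳ-≤ x 0≤y)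

*-zero-product : ∀ p q → p ℚ.* q ≡ 0ℚ → p ≡ 0ℚ ⊎ q ≡ 0ℚ
*-zero-product p q pq≡0 with p ℚP.≟ 0ℚ
... | yes p≡0 = inj₁ p≡0
... | no p≢0 = inj₂ (q≡0 {{ℚ.≢-nonZero p≢0}})
  where
  q≡0 : {{ℚ.NonZero p}} → q ≡ 0ℚ
  q≡0 = begin
    q                       ≡⟨ sym (ℚP.*-identityˡ q) ⟩
    1ℚ ℚ.* q                ≡⟨ cong (ℚ._* q) (sym (ℚP.*-inverseˡ p)) ⟩
    (ℚ.1/ p) ℚ.* p ℚ.* q    ≡⟨ ℚP.*-assoc (ℚ.1/ p) p q ⟩
    (ℚ.1/ p) ℚ.* (p ℚ.* q)  ≡⟨ cong ((ℚ.1/ p) ℚ.*_) pq≡0 ⟩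
    (ℚ.1/ p) ℚ.* 0ℚ         ≡⟨ ℚP.*-zeroʳ (ℚ.1/ p) ⟩
    0ℚ                      ∎
    where open ≡-Reasoning

-- Finite sums

sumQ-cong : ∀ {f g} a L → (∀ t → a ℕ.≤ t → t ℕ.< a ℕ.+ L → f t ≡ g t) → sumQ f a L ≡ sumQ g a L
sumQ-cong a zero    f≗g = refl
sumQ-cong a (suc L) f≗g = cong₂ ℚ._+_ (f≗g a ℕP.≤-refl (ℕP.m<m+n a (s≤s z≤n)))
  (sumQ-cong (suc a) L λ t a<t t<a+L → f≗g t (ℕP.<⇒≤ a<t) (subst (t ℕ.<_) (sym (ℕP.+-suc a L)) t<a+L))

sumQ-zero : ∀ {f} a L → (∀ t → a ℕ.≤ t → t ℕ.< a ℕ.+ L → f t ≡ 0ℚ) → sumQ f a L ≡ 0ℚ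
sumQ-zero a zero    f≗0 = refl
sumQ-zero a (suc L) f≗0 = trans
  (cong₂ ℚ._+_ (f≗0 a ℕP.≤-refl (ℕP.m<m+n a (s≤s z≤n)))
     (sumQ-zero (suc a) L λ t a<t t<a+L → f≗0 t (ℕP.<⇒≤ a<t) (subst (t ℕ.<_) (sym (ℕP.+-suc a L)) t<a+L)))
  (ℚP.+-identityʳ 0ℚ)

sumQ-+ : ∀ f g a L → sumQ (λ t → f t ℚ.+ g t) a L ≡ sumQ f a L ℚ.+ sumQ g a L
sumQ-+ f g a zero    = sym (ℚP.+-identityˡ 0ℚ)
sumQ-+ f g a (suc L) = trans (cong (f a ℚ.+ g a ℚ.+_) (sumQ-+ f g (suc a) L))
  (solve 4 (λ x y u v → (x :+ y) :+ (u :+ v) := (x :+ u) :+ (y :+ v)) refl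
     (f a) (g a) (sumQ f (suc a) L) (sumQ g (suc a) L))

sumQ-*ˡ : ∀ p f a L → sumQ (λ t → p ℚ.* f t) a L ≡ p ℚ.* sumQ f a L
sumQ-*ˡ p f a zero    = sym (ℚP.*-zeroʳ p)
sumQ-*ˡ p f a (suc L) = trans (cong (p ℚ.* f a ℚ.+_) (sumQ-*ˡ p f (suc a) L)) (sym (ℚP.*-distribˡ-+ p (f a) _))

sumQ-neg : ∀ f a L → sumQ (λ t → ℚ.- f t) a L ≡ ℚ.- sumQ f a L
sumQ-neg f a zero    = refl
sumQ-neg f a (suc L) = trans (cong (ℚ.- f a ℚ.+_) (sumQ-neg f (suc a) L)) (sym (ℚP.neg-distrib-+ (f a) _))

sumQ-swap : ∀ (F : ℕ → ℕ → ℚ) a L b K →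
  sumQ (λ s → sumQ (F s) a L) b K ≡ sumQ (λ t → sumQ (λ s → F s t) b K) a L
sumQ-swap F a L b zero    = sym (sumQ-zero a L λ _ _ _ → refl)
sumQ-swap F a L b (suc K) = trans (cong (sumQ (F b) a L ℚ.+_) (sumQ-swap F a L (suc b) K))
  (sym (sumQ-+ (F b) (λ t → sumQ (λ s → F s t) (suc b) K) a L))

sumQ-snoc : ∀ f a L → sumQ f a (suc L) ≡ sumQ f a L ℚ.+ f (a ℕ.+ L)
sumQ-snoc f a zero    = trans (ℚP.+-comm (f a) 0ℚ) (cong (λ s → 0ℚ ℚ.+ f s) (sym (ℕP.+-identityʳ a)))
sumQ-snoc f a (suc L) = begin
  f a ℚ.+ sumQ f (suc a) (suc L)                ≡⟨ cong (f a ℚ.+_) (sumQ-snoc f (suc a) L) ⟩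
  f a ℚ.+ (sumQ f (suc a) L ℚ.+ f (suc a ℕ.+ L)) ≡⟨ sym (ℚP.+-assoc (f a) _ _) ⟩
  f a ℚ.+ sumQ f (suc a) L ℚ.+ f (suc a ℕ.+ L)   ≡⟨ cong (λ s → f a ℚ.+ sumQ f (suc a) L ℚ.+ f s) (sym (ℕP.+-suc a L)) ⟩
  f a ℚ.+ sumQ f (suc a) L ℚ.+ f (a ℕ.+ suc L)   ∎
  where open ≡-Reasoning

sumQ-split : ∀ f a k l → sumQ f a (k ℕ.+ l) ≡ sumQ f a k ℚ.+ sumQ f (a ℕ.+ k) l
sumQ-split f a zero    l = sym (trans (ℚP.+-identityˡ _) (cong (λ s → sumQ f s l) (ℕP.+-identityʳ a)))
sumQ-split f a (suc k) l = begin
  f a ℚ.+ sumQ f (suc a) (k ℕ.+ l)                        ≡⟨ cong (f a ℚ.+_) (sumQ-split f (suc a) k l) ⟩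
  f a ℚ.+ (sumQ f (suc a) k ℚ.+ sumQ f (suc a ℕ.+ k) l)   ≡⟨ sym (ℚP.+-assoc (f a) _ _) ⟩
  f a ℚ.+ sumQ f (suc a) k ℚ.+ sumQ f (suc a ℕ.+ k) l     ≡⟨ cong (λ s → f a ℚ.+ sumQ f (suc a) k ℚ.+ sumQ f s l) (sym (ℕP.+-suc a k)) ⟩
  f a ℚ.+ sumQ f (suc a) k ℚ.+ sumQ f (a ℕ.+ suc k) l     ∎
  where open ≡-Reasoning

sumQ-subinterval : ∀ {f} a L a′ L′ → a ℕ.≤ a′ → a′ ℕ.+ L′ ℕ.≤ a ℕ.+ L →
  (∀ t → a ℕ.≤ t → t ℕ.< a ℕ.+ L → t ℕ.< a′ ⊎ a′ ℕ.+ L′ ℕ.≤ t → f t ≡ 0ℚ) →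
  sumQ f a L ≡ sumQ f a′ L′
sumQ-subinterval {f} a L a′ L′ a≤a′ end≤ f≗0 = begin
  sumQ f a L                                                  ≡⟨ cong (sumQ f a) L≡ ⟩
  sumQ f a (front ℕ.+ (L′ ℕ.+ back))                           ≡⟨ sumQ-split f a front _ ⟩
  sumQ f a front ℚ.+ sumQ f (a ℕ.+ front) (L′ ℕ.+ back)        ≡⟨ cong (λ s → sumQ f a front ℚ.+ sumQ f s (L′ ℕ.+ back)) a+front≡a′ ⟩
  sumQ f a front ℚ.+ sumQ f a′ (L′ ℕ.+ back)                   ≡⟨ cong (sumQ f a front ℚ.+_) (sumQ-split f a′ L′ back) ⟩
  sumQ f a front ℚ.+ (sumQ f a′ L′ ℚ.+ sumQ f (a′ ℕ.+ L′) back) ≡⟨ cong₂ (λ u v → u ℚ.+ (sumQ f a′ L′ ℚ.+ v)) front≡0 back≡0 ⟩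
  0ℚ ℚ.+ (sumQ f a′ L′ ℚ.+ 0ℚ)                                 ≡⟨ trans (ℚP.+-identityˡ _) (ℚP.+-identityʳ _) ⟩
  sumQ f a′ L′                                                 ∎
  where
  open ≡-Reasoning
  front back : ℕ
  front = a′ ∸ a
  back  = (a ℕ.+ L) ∸ (a′ ℕ.+ L′)
  a+front≡a′ : a ℕ.+ front ≡ a′
  a+front≡a′ = ℕP.m+[n∸m]≡n a≤a′
  end+back≡ : a′ ℕ.+ L′ ℕ.+ back ≡ a ℕ.+ L
  end+back≡ = ℕP.m+[n∸m]≡n end≤
  L≡ : L ≡ front ℕ.+ (L′ ℕ.+ back)
  L≡ = ℕP.+-cancelˡ-≡ a L _ (begin
    a ℕ.+ L                             ≡⟨ sym end+back≡ ⟩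
    a′ ℕ.+ L′ ℕ.+ back                  ≡⟨ cong (λ s → s ℕ.+ L′ ℕ.+ back) (sym a+front≡a′) ⟩
    a ℕ.+ front ℕ.+ L′ ℕ.+ back         ≡⟨ solve-+ a front L′ back ⟩
    a ℕ.+ (front ℕ.+ (L′ ℕ.+ back))     ∎)
    where
    solve-+ : ∀ w x y z → w ℕ.+ x ℕ.+ y ℕ.+ z ≡ w ℕ.+ (x ℕ.+ (y ℕ.+ z))
    solve-+ w x y z = trans (ℕP.+-assoc (w ℕ.+ x) y z) (ℕP.+-assoc w x (y ℕ.+ z))
  front≡0 : sumQ f a front ≡ 0ℚ
  front≡0 = sumQ-zero a front λ t a≤t t<a′ →
    let t<a′ = subst (t ℕ.<_) a+front≡a′ t<a′ in
    f≗0 t a≤t (ℕP.<-≤-trans t<a′ (ℕP.≤-trans (ℕP.m≤m+n a′ L′) end≤)) (inj₁ t<a′)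
  back≡0 : sumQ f (a′ ℕ.+ L′) back ≡ 0ℚ
  back≡0 = sumQ-zero (a′ ℕ.+ L′) back λ t end≤t t<end →
    f≗0 t (ℕP.≤-trans a≤a′ (ℕP.≤-trans (ℕP.m≤m+n a′ L′) end≤t)) (subst (t ℕ.<_) end+back≡ t<end) (inj₂ end≤t)

sumQ-single : ∀ {f} a L t₀ → a ℕ.≤ t₀ → t₀ ℕ.< a ℕ.+ L →
  (∀ t → a ℕ.≤ t → t ℕ.< a ℕ.+ L → t ≢ t₀ → f t ≡ 0ℚ) → sumQ f a L ≡ f t₀
sumQ-single {f} a L t₀ a≤t₀ t₀<a+L f≗0 = trans
  (sumQ-subinterval a L t₀ 1 a≤t₀ (subst (ℕ._≤ a ℕ.+ L) (ℕP.+-comm 1 t₀) t₀<a+L)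
     λ t a≤t t<a+L outside → f≗0 t a≤t t<a+L (λ { refl → not-t₀ outside }))
  (ℚP.+-identityʳ (f t₀))
  where
  not-t₀ : t₀ ℕ.< t₀ ⊎ t₀ ℕ.+ 1 ℕ.≤ t₀ → _
  not-t₀ (inj₁ t₀<t₀)  = ⊥-elim (ℕP.<-irrefl refl t₀<t₀)
  not-t₀ (inj₂ t₀+1≤t₀) = ⊥-elim (ℕP.<-irrefl refl (subst (ℕ._≤ t₀) (ℕP.+-comm t₀ 1) t₀+1≤t₀))

sumQ-except : ∀ {f g} a L t₀ → a ℕ.≤ t₀ → t₀ ℕ.< a ℕ.+ L →
  (∀ t → a ℕ.≤ t → t ℕ.< a ℕ.+ L → t ≢ t₀ → f t ≡ g t) →
  sumQ f a L ≡ sumQ g a L ℚ.+ (f t₀ ℚ.- g t₀)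
sumQ-except {f} {g} a L t₀ a≤t₀ t₀<a+L f≗g = begin
  sumQ f a L                                               ≡⟨ sumQ-cong a L (λ t _ _ → sym (p+[q-p]≡q (g t) (f t))) ⟩
  sumQ (λ t → g t ℚ.+ (f t ℚ.- g t)) a L                   ≡⟨ sumQ-+ g (λ t → f t ℚ.- g t) a L ⟩
  sumQ g a L ℚ.+ sumQ (λ t → f t ℚ.- g t) a L              ≡⟨ cong (sumQ g a L ℚ.+_) (sumQ-single a L t₀ a≤t₀ t₀<a+L
                                                                λ t a≤t t<a+L t≢t₀ → trans (cong (ℚ._- g t) (f≗g t a≤t t<a+L t≢t₀)) (ℚP.+-inverseʳ (g t))) ⟩
  sumQ g a L ℚ.+ (f t₀ ℚ.- g t₀)                           ∎
  where open ≡-Reasoning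

sumQ-mono : ∀ {f g} a L → (∀ t → a ℕ.≤ t → t ℕ.< a ℕ.+ L → f t ℚ.≤ g t) → sumQ f a L ℚ.≤ sumQ g a L
sumQ-mono a zero    f≤g = ℚP.≤-refl
sumQ-mono a (suc L) f≤g = ℚP.+-mono-≤ (f≤g a ℕP.≤-refl (ℕP.m<m+n a (s≤s z≤n)))
  (sumQ-mono (suc a) L λ t a<t t<a+L → f≤g t (ℕP.<⇒≤ a<t) (subst (t ℕ.<_) (sym (ℕP.+-suc a L)) t<a+L))

sumQ-nonNeg : ∀ {f} a L → (∀ t → a ℕ.≤ t → t ℕ.< a ℕ.+ L → 0ℚ ℚ.≤ f t) → 0ℚ ℚ.≤ sumQ f a L
sumQ-nonNeg {f} a L 0≤f = subst (ℚ._≤ sumQ f a L) (sumQ-zero a L λ _ _ _ → refl) (sumQ-mono a L 0≤f)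

term≤sumQ : ∀ {f} a L → (∀ t → a ℕ.≤ t → t ℕ.< a ℕ.+ L → 0ℚ ℚ.≤ f t) →
  ∀ t → a ℕ.≤ t → t ℕ.< a ℕ.+ L → f t ℚ.≤ sumQ f a L
term≤sumQ {f} a L 0≤f t a≤t t<a+L = begin
  f t                  ≡⟨ sym (if-yes (t ℕ.≟ t) refl) ⟩
  only-t t             ≡⟨ sym (sumQ-single a L t a≤t t<a+L (λ s _ _ → if-no (s ℕ.≟ t))) ⟩
  sumQ only-t a L      ≤⟨ sumQ-mono a L (λ s a≤s s<a+L → only-t≤f s (0≤f s a≤s s<a+L)) ⟩
  sumQ f a L           ∎
  where
  open ℚP.≤-Reasoning
  only-t : ℕ → ℚ
  only-t s = if does (s ℕ.≟ t) then f s else 0ℚ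
  only-t≤f : ∀ s → 0ℚ ℚ.≤ f s → only-t s ℚ.≤ f s
  only-t≤f s 0≤fs with s ℕ.≟ t
  ... | yes s≡t = ℚP.≤-reflexive (if-yes (s ℕ.≟ t) s≡t)
  ... | no s≢t  = subst (ℚ._≤ f s) (sym (if-no (s ℕ.≟ t) s≢t)) 0≤fs

sumQ-nonNeg≡0 : ∀ {f} a L → (∀ t → a ℕ.≤ t → t ℕ.< a ℕ.+ L → 0ℚ ℚ.≤ f t) →
  sumQ f a L ≡ 0ℚ → ∀ t → a ℕ.≤ t → t ℕ.< a ℕ.+ L → f t ≡ 0ℚ
sumQ-nonNeg≡0 a L 0≤f Σ≡0 t a≤t t<a+L =
  ℚP.≤-antisym (subst (_ ℚ.≤_) Σ≡0 (term≤sumQ a L 0≤f t a≤t t<a+L)) (0≤f t a≤t t<a+L)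

sumQ-ℕ→ℚ : ∀ f a L → sumQ (λ t → ℕ→ℚ (f t)) a L ≡ ℕ→ℚ (sumR f a L)
sumQ-ℕ→ℚ f a zero    = refl
sumQ-ℕ→ℚ f a (suc L) = trans (cong (ℕ→ℚ (f a) ℚ.+_) (sumQ-ℕ→ℚ f (suc a) L)) (sym (ℕ→ℚ-homo-+ (f a) _))

sumR-snoc : ∀ f a L → sumR f a (suc L) ≡ sumR f a L ℕ.+ f (a ℕ.+ L)
sumR-snoc f a zero    = trans (ℕP.+-comm (f a) 0) (cong f (sym (ℕP.+-identityʳ a)))
sumR-snoc f a (suc L) = begin
  f a ℕ.+ sumR f (suc a) (suc L)                 ≡⟨ cong (f a ℕ.+_) (sumR-snoc f (suc a) L) ⟩
  f a ℕ.+ (sumR f (suc a) L ℕ.+ f (suc a ℕ.+ L)) ≡⟨ sym (ℕP.+-assoc (f a) _ _) ⟩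
  f a ℕ.+ sumR f (suc a) L ℕ.+ f (suc a ℕ.+ L)   ≡⟨ cong (λ s → f a ℕ.+ sumR f (suc a) L ℕ.+ f s) (sym (ℕP.+-suc a L)) ⟩
  f a ℕ.+ sumR f (suc a) L ℕ.+ f (a ℕ.+ suc L)   ∎
  where open ≡-Reasoning

-- Convex hulls of finitely many points

dot-cong : ∀ d g {x y} → x ≐[ d ] y → dot d g x ≡ dot d g y
dot-cong d g x≐y = sumQ-cong 1 d λ m 1≤m m<1+d → cong (g m ℚ.*_) (x≐y m 1≤m (ℕP.≤-pred m<1+d))

dot-combination : ∀ d g y z t s → dot d g (λ m → t ℚ.* y m ℚ.+ s ℚ.* z m) ≡ t ℚ.* dot d g y ℚ.+ s ℚ.* dot d g z
dot-combination d g y z t s = begin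
  sumQ (λ m → g m ℚ.* (t ℚ.* y m ℚ.+ s ℚ.* z m)) 1 d
    ≡⟨ sumQ-cong 1 d (λ m _ _ → solve 5 (λ g t y s z → g :* (t :* y :+ s :* z) := t :* (g :* y) :+ s :* (g :* z))
                                  refl (g m) t (y m) s (z m)) ⟩
  sumQ (λ m → t ℚ.* (g m ℚ.* y m) ℚ.+ s ℚ.* (g m ℚ.* z m)) 1 d
    ≡⟨ sumQ-+ (λ m → t ℚ.* (g m ℚ.* y m)) (λ m → s ℚ.* (g m ℚ.* z m)) 1 d ⟩
  sumQ (λ m → t ℚ.* (g m ℚ.* y m)) 1 d ℚ.+ sumQ (λ m → s ℚ.* (g m ℚ.* z m)) 1 d
    ≡⟨ cong₂ ℚ._+_ (sumQ-*ˡ t (λ m → g m ℚ.* y m) 1 d) (sumQ-*ˡ s (λ m → g m ℚ.* z m) 1 d) ⟩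
  t ℚ.* dot d g y ℚ.+ s ℚ.* dot d g z ∎
  where open ≡-Reasoning

comb : (ℕ → ℚ) → (ℕ → Pt) → ℕ → Pt
comb w P L m = sumQ (λ q → w q ℚ.* P q m) 0 L

dot-comb : ∀ d g w P L → dot d g (comb w P L) ≡ sumQ (λ q → w q ℚ.* dot d g (P q)) 0 L
dot-comb d g w P L = begin
  sumQ (λ m → g m ℚ.* sumQ (λ q → w q ℚ.* P q m) 0 L) 1 d
    ≡⟨ sumQ-cong 1 d (λ m _ _ → sym (sumQ-*ˡ (g m) (λ q → w q ℚ.* P q m) 0 L)) ⟩
  sumQ (λ m → sumQ (λ q → g m ℚ.* (w q ℚ.* P q m)) 0 L) 1 d
    ≡⟨ sumQ-swap (λ m q → g m ℚ.* (w q ℚ.* P q m)) 0 L 1 d ⟩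
  sumQ (λ q → sumQ (λ m → g m ℚ.* (w q ℚ.* P q m)) 1 d) 0 L
    ≡⟨ sumQ-cong 0 L (λ q _ _ → trans (sumQ-cong 1 d λ m _ _ → solve 3 (λ g w p → g :* (w :* p) := w :* (g :* p)) refl (g m) (w q) (P q m))
                                      (sumQ-*ˡ (w q) (λ m → g m ℚ.* P q m) 1 d)) ⟩
  sumQ (λ q → w q ℚ.* dot d g (P q)) 0 L ∎
  where open ≡-Reasoning

weight≡0-or-at-max : ∀ {s x M} → s ℚ.* (M ℚ.- x) ≡ 0ℚ → s ≡ 0ℚ ⊎ x ≡ M
weight≡0-or-at-max {s} {x} {M} gap≡0 = Sum.map₂ q-p≡0⇒p≡q (*-zero-product s (M ℚ.- x) gap≡0)

ConvexWeights : ℕ → (ℕ → ℚ) → Set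
ConvexWeights L w = (∀ q → q ℕ.< L → 0ℚ ℚ.≤ w q) × (sumQ w 0 L ≡ 1ℚ)

weighted-mean-gap : ∀ (w f : ℕ → ℚ) M L → sumQ w 0 L ≡ 1ℚ →
  M ℚ.- sumQ (λ q → w q ℚ.* f q) 0 L ≡ sumQ (λ q → w q ℚ.* (M ℚ.- f q)) 0 L
weighted-mean-gap w f M L Σw≡1 = sym (begin
  sumQ (λ q → w q ℚ.* (M ℚ.- f q)) 0 L
    ≡⟨ sumQ-cong 0 L (λ q _ _ → solve 3 (λ w M f → w :* (M :- f) := M :* w :+ :- (w :* f)) refl (w q) M (f q)) ⟩
  sumQ (λ q → M ℚ.* w q ℚ.+ ℚ.- (w q ℚ.* f q)) 0 L
    ≡⟨ sumQ-+ (λ q → M ℚ.* w q) (λ q → ℚ.- (w q ℚ.* f q)) 0 L ⟩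
  sumQ (λ q → M ℚ.* w q) 0 L ℚ.+ sumQ (λ q → ℚ.- (w q ℚ.* f q)) 0 L
    ≡⟨ cong₂ ℚ._+_ (trans (sumQ-*ˡ M w 0 L) (trans (cong (M ℚ.*_) Σw≡1) (ℚP.*-identityʳ M)))
                   (sumQ-neg (λ q → w q ℚ.* f q) 0 L) ⟩
  M ℚ.- sumQ (λ q → w q ℚ.* f q) 0 L ∎)
  where open ≡-Reasoning

module _ {L : ℕ} {w : ℕ → ℚ} (cw : ConvexWeights L w) {f : ℕ → ℚ} {M : ℚ} (f≤M : ∀ q → q ℕ.< L → f q ℚ.≤ M) where

  private
    gap≥0 : ∀ q → 0 ℕ.≤ q → q ℕ.< L → 0ℚ ℚ.≤ w q ℚ.* (M ℚ.- f q)
    gap≥0 q _ q<L = *-nonNeg (proj₁ cw q q<L) (p≤q⇒0≤q-p (f≤M q q<L))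

  weighted-mean-≤ : sumQ (λ q → w q ℚ.* f q) 0 L ℚ.≤ M
  weighted-mean-≤ = 0≤q-p⇒p≤q (subst (0ℚ ℚ.≤_) (sym (weighted-mean-gap w f M L (proj₂ cw))) (sumQ-nonNeg 0 L gap≥0))

  weighted-mean-attains-max : sumQ (λ q → w q ℚ.* f q) 0 L ≡ M → ∀ q → q ℕ.< L → w q ≡ 0ℚ ⊎ f q ≡ M
  weighted-mean-attains-max mean≡M q q<L = weight≡0-or-at-max (sumQ-nonNeg≡0 0 L gap≥0 gaps≡0 q z≤n q<L)
    where
    gaps≡0 : sumQ (λ q → w q ℚ.* (M ℚ.- f q)) 0 L ≡ 0ℚ
    gaps≡0 = trans (sym (weighted-mean-gap w f M L (proj₂ cw))) (trans (cong (λ s → M ℚ.- s) mean≡M) (ℚP.+-inverseʳ M))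

two-point-mean-attains-max : ∀ {t u v M} → 0ℚ ℚ.< t → t ℚ.< 1ℚ → u ℚ.≤ M → v ℚ.≤ M →
  t ℚ.* u ℚ.+ (1ℚ ℚ.- t) ℚ.* v ≡ M → u ≡ M × v ≡ M
two-point-mean-attains-max {t} {u} {v} {M} 0<t t<1 u≤M v≤M mean≡M =
  at-max 0<t (proj₁ gaps≡0) , at-max (p<q⇒0<q-p t<1) (proj₂ gaps≡0)
  where
  gaps≡0 : t ℚ.* (M ℚ.- u) ≡ 0ℚ × (1ℚ ℚ.- t) ℚ.* (M ℚ.- v) ≡ 0ℚ
  gaps≡0 = nonNeg+nonNeg≡0 (*-nonNeg (ℚP.<⇒≤ 0<t) (p≤q⇒0≤q-p u≤M)) (*-nonNeg (ℚP.<⇒≤ (p<q⇒0<q-p t<1)) (p≤q⇒0≤q-p v≤M))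
    (trans (solve 4 (λ t M u v → t :* (M :- u) :+ (con 1ℚ :- t) :* (M :- v) := M :- (t :* u :+ (con 1ℚ :- t) :* v)) refl t M u v)
           (trans (cong (λ s → M ℚ.- s) mean≡M) (ℚP.+-inverseʳ M)))
  at-max : ∀ {s x} → 0ℚ ℚ.< s → s ℚ.* (M ℚ.- x) ≡ 0ℚ → x ≡ M
  at-max 0<s gap≡0 = [ (λ s≡0 → ⊥-elim (ℚP.<-irrefl (sym s≡0) 0<s)) , id ]′ (weight≡0-or-at-max gap≡0)

InHull : ℕ → (ℕ → Pt) → ℕ → Pt → Set
InHull d P L x = Σ (ℕ → ℚ) λ w → ConvexWeights L w × x ≐[ d ] comb w P L

module Hull (d : ℕ) (P : ℕ → Pt) (L : ℕ) where

  generator∈hull : ∀ q → q ℕ.< L → InHull d P L (P q)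
  generator∈hull q q<L = δ , (δ≥0 , Σδ≡1) , P≐comb
    where
    δ : ℕ → ℚ
    δ s = if does (s ℕ.≟ q) then 1ℚ else 0ℚ
    δ≡0 : ∀ s → s ≢ q → δ s ≡ 0ℚ
    δ≡0 s = if-no (s ℕ.≟ q)
    δ≥0 : ∀ s → s ℕ.< L → 0ℚ ℚ.≤ δ s
    δ≥0 s _ = if-elim (0ℚ ℚ.≤_) (s ℕ.≟ q) (ℚP.<⇒≤ 0<1) ℚP.≤-refl
    Σδ≡1 : sumQ δ 0 L ≡ 1ℚ
    Σδ≡1 = trans (sumQ-single 0 L q z≤n q<L λ s _ _ → δ≡0 s) (if-yes (q ℕ.≟ q) refl)
    P≐comb : P q ≐[ d ] comb δ P L
    P≐comb m _ _ = sym (begin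
      sumQ (λ s → δ s ℚ.* P s m) 0 L ≡⟨ sumQ-single 0 L q z≤n q<L (λ s _ _ s≢q → trans (cong (ℚ._* P s m) (δ≡0 s s≢q)) (ℚP.*-zeroˡ (P s m))) ⟩
      δ q ℚ.* P q m                  ≡⟨ cong (ℚ._* P q m) (if-yes (q ℕ.≟ q) refl) ⟩
      1ℚ ℚ.* P q m                   ≡⟨ ℚP.*-identityˡ _ ⟩
      P q m                          ∎)
      where open ≡-Reasoning

  hull-dot : ∀ g {x} w → x ≐[ d ] comb w P L → dot d g x ≡ sumQ (λ q → w q ℚ.* dot d g (P q)) 0 L
  hull-dot g w x≐comb = trans (dot-cong d g x≐comb) (dot-comb d g w P L)

  hull-dot-≤ : ∀ g M {x} → InHull d P L x → (∀ q → q ℕ.< L → dot d g (P q) ℚ.≤ M) → dot d g x ℚ.≤ M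
  hull-dot-≤ g M (w , cw , x≐comb) gP≤M = subst (ℚ._≤ M) (sym (hull-dot g w x≐comb)) (weighted-mean-≤ cw gP≤M)

  StrictMaxAt : Pt → ℕ → Set
  StrictMaxAt g q₀ = ∀ q → q ℕ.< L → q ≢ q₀ → dot d g (P q) ℚ.< dot d g (P q₀)

  module _ {g q₀} (q₀<L : q₀ ℕ.< L) (max : StrictMaxAt g q₀) where

    private
      gP≤max : ∀ q → q ℕ.< L → dot d g (P q) ℚ.≤ dot d g (P q₀)
      gP≤max q q<L with q ℕ.≟ q₀
      ... | yes refl = ℚP.≤-refl
      ... | no q≢q₀  = ℚP.<⇒≤ (max q q<L q≢q₀)

    strictMax⇒unique-maximiser : ∀ {y} → InHull d P L y → dot d g y ≡ dot d g (P q₀) → y ≐[ d ] P q₀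
    strictMax⇒unique-maximiser {y} (w , cw , y≐comb) gy≡max m 1≤m m≤d = begin
      y m                               ≡⟨ y≐comb m 1≤m m≤d ⟩
      sumQ (λ q → w q ℚ.* P q m) 0 L    ≡⟨ sumQ-single 0 L q₀ z≤n q₀<L (λ q _ q<L q≢q₀ → trans (cong (ℚ._* P q m) (w≡0 q q<L q≢q₀)) (ℚP.*-zeroˡ (P q m))) ⟩
      w q₀ ℚ.* P q₀ m                   ≡⟨ cong (ℚ._* P q₀ m) w₀≡1 ⟩
      1ℚ ℚ.* P q₀ m                     ≡⟨ ℚP.*-identityˡ _ ⟩
      P q₀ m                            ∎
      where
      open ≡-Reasoning
      w≡0 : ∀ q → q ℕ.< L → q ≢ q₀ → w q ≡ 0ℚ
      w≡0 q q<L q≢q₀ = [ id , (λ gP≡max → ⊥-elim (ℚP.<-irrefl gP≡max (max q q<L q≢q₀))) ]′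
        (weighted-mean-attains-max cw gP≤max (trans (sym (hull-dot g w y≐comb)) gy≡max) q q<L)
      w₀≡1 : w q₀ ≡ 1ℚ
      w₀≡1 = trans (sym (sumQ-single 0 L q₀ z≤n q₀<L λ q _ q<L → w≡0 q q<L)) (proj₂ cw)

    strictMax⇒extreme : (Q : Pt → Set) → (∀ x → Q x → InHull d P L x) → Q (P q₀) → IsExtreme d Q (P q₀)
    strictMax⇒extreme Q Q⊆hull Q[P₀] = Q[P₀] , λ y z t Qy Qz 0<t t<1 P₀≐yz →
      let gy≡max , gz≡max = two-point-mean-attains-max 0<t t<1
                              (hull-dot-≤ g _ (Q⊆hull y Qy) gP≤max) (hull-dot-≤ g _ (Q⊆hull z Qz) gP≤max)
                              (sym (trans (dot-cong d g P₀≐yz) (dot-combination d g y z t (1ℚ ℚ.- t))))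
      in λ m 1≤m m≤d → trans (strictMax⇒unique-maximiser (Q⊆hull y Qy) gy≡max m 1≤m m≤d)
                             (sym (strictMax⇒unique-maximiser (Q⊆hull z Qz) gz≡max m 1≤m m≤d))

  hull-face-equation : ∀ a β c γ → (∀ q → q ℕ.< L → dot d a (P q) ℚ.≤ β) →
    (∀ q → q ℕ.< L → dot d a (P q) ≡ β → dot d c (P q) ≡ γ) →
    ∀ {x} → InHull d P L x → dot d a x ≡ β → dot d c x ≡ γ
  hull-face-equation a β c γ aP≤β face⇒cP≡γ {x} (w , cw , x≐comb) ax≡β = begin
    dot d c x                                   ≡⟨ hull-dot c w x≐comb ⟩
    sumQ (λ q → w q ℚ.* dot d c (P q)) 0 L      ≡⟨ sumQ-cong 0 L (λ q _ q<L → weighted-term q q<L) ⟩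
    sumQ (λ q → γ ℚ.* w q) 0 L                  ≡⟨ sumQ-*ˡ γ w 0 L ⟩
    γ ℚ.* sumQ w 0 L                            ≡⟨ cong (γ ℚ.*_) (proj₂ cw) ⟩
    γ ℚ.* 1ℚ                                    ≡⟨ ℚP.*-identityʳ γ ⟩
    γ                                           ∎
    where
    open ≡-Reasoning
    weighted-term : ∀ q → q ℕ.< L → w q ℚ.* dot d c (P q) ≡ γ ℚ.* w q
    weighted-term q q<L =
      [ (λ w≡0 → trans (cong (ℚ._* dot d c (P q)) w≡0)
                   (trans (ℚP.*-zeroˡ (dot d c (P q))) (sym (trans (cong (γ ℚ.*_) w≡0) (ℚP.*-zeroʳ γ)))))
      , (λ aP≡β → trans (cong (w q ℚ.*_) (face⇒cP≡γ q q<L aP≡β)) (ℚP.*-comm (w q) γ))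
      ]′ (weighted-mean-attains-max cw aP≤β (trans (sym (hull-dot a w x≐comb)) ax≡β) q q<L)

-- The polytope Δ

<⇒≤∸1 : ∀ {i j} → i ℕ.< j → i ℕ.≤ j ∸ 1
<⇒≤∸1 (s≤s i≤j) = i≤j

module Polytope (r : ℕ) (ns b : ℕ → ℕ) where

  n : ℕ
  n = N ns r

  vertexCount : ℕ
  vertexCount = n ℕ.+ r ℕ.+ 2

  <vertexCount⇒≤ : ∀ {q} → q ℕ.< vertexCount → q ℕ.≤ n ℕ.+ r ℕ.+ 1
  <vertexCount⇒≤ {q} q<count = ℕP.≤-pred (subst (q ℕ.<_) (ℕP.+-suc (n ℕ.+ r) 1) q<count)

  ≤⇒<vertexCount : ∀ {q} → q ℕ.≤ n ℕ.+ r ℕ.+ 1 → q ℕ.< vertexCount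
  ≤⇒<vertexCount {q} q≤ = subst (q ℕ.<_) (sym (ℕP.+-suc (n ℕ.+ r) 1)) (s≤s q≤)

  open Hull (suc n) (V r ns b) vertexCount public

  Δ⇒hull : ∀ {x} → InΔ r ns b x → InHull (suc n) (V r ns b) vertexCount x
  Δ⇒hull (w , w≥0 , Σw≡1 , x≐comb) = w , ((λ q q<count → w≥0 q (<vertexCount⇒≤ q<count)) , Σw≡1) , x≐comb

  hull⇒Δ : ∀ {x} → InHull (suc n) (V r ns b) vertexCount x → InΔ r ns b x
  hull⇒Δ (w , (w≥0 , Σw≡1) , x≐comb) = w , (λ q q≤ → w≥0 q (≤⇒<vertexCount q≤)) , Σw≡1 , x≐comb

  V∈Δ : ∀ q → q ℕ.< vertexCount → InΔ r ns b (V r ns b q)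
  V∈Δ q q<count = hull⇒Δ (generator∈hull q q<count)

  InBlock : ℕ → ℕ → Set
  InBlock i t = N ns (i ∸ 1) ℕ.< t × t ℕ.≤ N ns i

  inBlock? : ∀ i t → Dec (InBlock i t)
  inBlock? i t = (N ns (i ∸ 1) ℕ.<? t) ×-dec (t ℕ.≤? N ns i)

  blockStart : ℕ → ℕ
  blockStart i = suc (N ns (i ∸ 1))

  N-suc : ∀ i → N ns (suc i) ≡ N ns i ℕ.+ ns (suc i)
  N-suc i = sumR-snoc ns 1 i

  N-mono : ∀ {i j} → i ℕ.≤ j → N ns i ℕ.≤ N ns j
  N-mono {j = zero} z≤n = ℕP.≤-refl
  N-mono {i} {suc j} i≤1+j with ℕP.m≤n⇒m<n∨m≡n i≤1+j
  ... | inj₂ refl       = ℕP.≤-refl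
  ... | inj₁ (s≤s i≤j)  = ℕP.≤-trans (N-mono i≤j) (subst (N ns j ℕ.≤_) (sym (N-suc j)) (ℕP.m≤m+n _ _))

  blockEnd : ∀ {i} → 1 ℕ.≤ i → blockStart i ℕ.+ ns i ≡ suc (N ns i)
  blockEnd {suc i} _ = cong suc (sym (N-suc i))

  inBlock⇒range : ∀ {i t} → 1 ℕ.≤ i → InBlock i t → blockStart i ℕ.≤ t × t ℕ.< blockStart i ℕ.+ ns i
  inBlock⇒range {t = t} 1≤i (start≤t , t≤N) = start≤t , subst (t ℕ.<_) (sym (blockEnd 1≤i)) (s≤s t≤N)

  range⇒inBlock : ∀ {i t} → 1 ℕ.≤ i → blockStart i ℕ.≤ t → t ℕ.< blockStart i ℕ.+ ns i → InBlock i t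
  range⇒inBlock {t = t} 1≤i start≤t t<end = start≤t , ℕP.≤-pred (subst (t ℕ.<_) (blockEnd 1≤i) t<end)

  inBlock⇒≤n : ∀ {i t} → i ℕ.≤ r → InBlock i t → t ℕ.≤ n
  inBlock⇒≤n i≤r (_ , t≤N) = ℕP.≤-trans t≤N (N-mono i≤r)

  inBlock-unique : ∀ {i j t} → InBlock i t → InBlock j t → i ≡ j
  inBlock-unique {i} {j} (Nᵢ₋₁<t , t≤Nᵢ) (Nⱼ₋₁<t , t≤Nⱼ) with ℕP.<-cmp i j
  ... | tri≈ _ i≡j _ = i≡j
  ... | tri< i<j _ _ = ⊥-elim (ℕP.<⇒≱ Nⱼ₋₁<t (ℕP.≤-trans t≤Nᵢ (N-mono (<⇒≤∸1 i<j))))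
  ... | tri> _ _ j<i = ⊥-elim (ℕP.<⇒≱ Nᵢ₋₁<t (ℕP.≤-trans t≤Nⱼ (N-mono (<⇒≤∸1 j<i))))

  data VertexIndex : ℕ → Set where
    origin : VertexIndex 0
    basis  : ∀ {q} → 1 ℕ.≤ q → q ℕ.≤ suc n → VertexIndex q
    hub    : ∀ {i} → 1 ℕ.≤ i → i ℕ.≤ r → VertexIndex (suc n ℕ.+ i)

  vertexIndex : ∀ q → q ℕ.< vertexCount → VertexIndex q
  vertexIndex zero    _ = origin
  vertexIndex (suc q) q<count with suc q ℕ.≤? suc n
  ... | yes q≤n = basis (s≤s z≤n) q≤n
  ... | no q≰n  = subst VertexIndex (ℕP.m+[n∸m]≡n (ℕP.<⇒≤ n<q)) (hub (ℕP.m<n⇒0<n∸m n<q) i≤r)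
    where
    n<q : suc n ℕ.< suc q
    n<q = ℕP.≰⇒> q≰n
    i≤r : suc q ∸ suc n ℕ.≤ r
    i≤r = subst (q ∸ n ℕ.≤_) (ℕP.m+n∸m≡n n r)
            (ℕP.∸-monoˡ-≤ n (ℕP.≤-pred (subst (suc q ℕ.≤_) (ℕP.+-comm (n ℕ.+ r) 1) (<vertexCount⇒≤ q<count))))

  hubPoint : ℕ → Pt
  hubPoint i m = if does (m ℕ.≟ suc n) then 1ℚ else if does (inBlock? i m) then ℚ.- ℕ→ℚ (b m) else 0ℚ

  V-basis : ∀ {q} → 1 ℕ.≤ q → q ℕ.≤ suc n → ∀ m → V r ns b q m ≡ (if does (m ℕ.≟ q) then 1ℚ else 0ℚ)
  V-basis {suc q} _ q≤n m = if-yes (suc q ℕ.≤? suc n) q≤n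

  V-hub : ∀ {i} → 1 ℕ.≤ i → ∀ m → V r ns b (suc n ℕ.+ i) m ≡ hubPoint i m
  V-hub {i} 1≤i m = trans (if-no (suc n ℕ.+ i ℕ.≤? suc n) n+i≰n) (cong (λ k → hubPoint k m) (ℕP.m+n∸m≡n (suc n) i))
    where
    n+i≰n : ¬ (suc n ℕ.+ i ℕ.≤ suc n)
    n+i≰n = ℕP.<⇒≱ (subst (ℕ._≤ suc n ℕ.+ i) (ℕP.+-comm (suc n) 1) (ℕP.+-monoʳ-≤ (suc n) 1≤i))

  ≤n⇒≢suc : ∀ {t} → t ℕ.≤ n → t ≢ suc n
  ≤n⇒≢suc t≤n refl = ℕP.<-irrefl refl t≤n

  blockSum : Pt → ℕ → ℚ
  blockSum g i = sumQ (λ t → g t ℚ.* ℕ→ℚ (b t)) (blockStart i) (ns i)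

  dot-V-origin : ∀ g → dot (suc n) g (V r ns b 0) ≡ 0ℚ
  dot-V-origin g = sumQ-zero 1 (suc n) λ t _ _ → ℚP.*-zeroʳ (g t)

  dot-V-basis : ∀ g {q} → 1 ℕ.≤ q → q ℕ.≤ suc n → dot (suc n) g (V r ns b q) ≡ g q
  dot-V-basis g {q} 1≤q q≤n = begin
    dot (suc n) g (V r ns b q)                ≡⟨ sumQ-single 1 (suc n) q 1≤q (s≤s q≤n) (λ t _ _ t≢q → coordinate≡0 t t≢q) ⟩
    g q ℚ.* V r ns b q q                      ≡⟨ cong (g q ℚ.*_) (trans (V-basis 1≤q q≤n q) (if-yes (q ℕ.≟ q) refl)) ⟩
    g q ℚ.* 1ℚ                                ≡⟨ ℚP.*-identityʳ (g q) ⟩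
    g q                                       ∎
    where
    open ≡-Reasoning
    coordinate≡0 : ∀ t → t ≢ q → g t ℚ.* V r ns b q t ≡ 0ℚ
    coordinate≡0 t t≢q = trans (cong (g t ℚ.*_) (trans (V-basis 1≤q q≤n t) (if-no (t ℕ.≟ q) t≢q))) (ℚP.*-zeroʳ (g t))

  dot-V-hub : ∀ g {i} → 1 ℕ.≤ i → i ℕ.≤ r → dot (suc n) g (V r ns b (suc n ℕ.+ i)) ≡ g (suc n) ℚ.- blockSum g i
  dot-V-hub g {i} 1≤i i≤r = begin
    dot (suc n) g (V r ns b (suc n ℕ.+ i))                        ≡⟨ sumQ-cong 1 (suc n) (λ m _ _ → cong (g m ℚ.*_) (V-hub 1≤i m)) ⟩
    sumQ (λ m → g m ℚ.* hubPoint i m) 1 (suc n)                   ≡⟨ sumQ-snoc (λ m → g m ℚ.* hubPoint i m) 1 n ⟩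
    sumQ (λ m → g m ℚ.* hubPoint i m) 1 n ℚ.+ g (suc n) ℚ.* hubPoint i (suc n)
      ≡⟨ cong₂ ℚ._+_ supported-on-block (trans (cong (g (suc n) ℚ.*_) (if-yes (suc n ℕ.≟ suc n) refl)) (ℚP.*-identityʳ _)) ⟩
    sumQ (λ t → ℚ.- (g t ℚ.* ℕ→ℚ (b t))) (blockStart i) (ns i) ℚ.+ g (suc n)
      ≡⟨ cong (ℚ._+ g (suc n)) (sumQ-neg (λ t → g t ℚ.* ℕ→ℚ (b t)) (blockStart i) (ns i)) ⟩
    ℚ.- blockSum g i ℚ.+ g (suc n)                                ≡⟨ ℚP.+-comm _ (g (suc n)) ⟩
    g (suc n) ℚ.- blockSum g i                                    ∎
    where
    open ≡-Reasoning
    hub-off-top : ∀ t → t ℕ.≤ n → hubPoint i t ≡ (if does (inBlock? i t) then ℚ.- ℕ→ℚ (b t) else 0ℚ)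
    hub-off-top t t≤n = if-no (t ℕ.≟ suc n) (≤n⇒≢suc t≤n)
    block≤n : blockStart i ℕ.+ ns i ℕ.≤ 1 ℕ.+ n
    block≤n = subst (ℕ._≤ suc n) (sym (blockEnd 1≤i)) (s≤s (N-mono i≤r))
    supported-on-block : sumQ (λ m → g m ℚ.* hubPoint i m) 1 n ≡ sumQ (λ t → ℚ.- (g t ℚ.* ℕ→ℚ (b t))) (blockStart i) (ns i)
    supported-on-block = trans
      (sumQ-subinterval 1 n (blockStart i) (ns i) (s≤s z≤n) block≤n λ t _ t<1+n outside →
         trans (cong (g t ℚ.*_) (trans (hub-off-top t (ℕP.≤-pred t<1+n))
                                       (if-no (inBlock? i t) (λ t∈i → outside-block outside (inBlock⇒range 1≤i t∈i)))))
               (ℚP.*-zeroʳ (g t)))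
      (sumQ-cong (blockStart i) (ns i) λ t start≤t t<end →
         let t∈i = range⇒inBlock 1≤i start≤t t<end in
         trans (cong (g t ℚ.*_) (trans (hub-off-top t (inBlock⇒≤n i≤r t∈i)) (if-yes (inBlock? i t) t∈i)))
               (sym (ℚP.neg-distribʳ-* (g t) _)))
      where
      outside-block : ∀ {t} → t ℕ.< blockStart i ⊎ blockStart i ℕ.+ ns i ℕ.≤ t →
                      ¬ (blockStart i ℕ.≤ t × t ℕ.< blockStart i ℕ.+ ns i)
      outside-block (inj₁ t<start) (start≤t , _) = ℕP.<⇒≱ t<start start≤t
      outside-block (inj₂ end≤t)   (_ , t<end)   = ℕP.<⇒≱ t<end end≤t

  blockWeight : ℕ → ℕ
  blockWeight i = sumR b (blockStart i) (ns i)

  blockSum-ones : ∀ {g} i → (∀ t → blockStart i ℕ.≤ t → t ℕ.< blockStart i ℕ.+ ns i → g t ≡ 1ℚ) →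
                  blockSum g i ≡ ℕ→ℚ (blockWeight i)
  blockSum-ones {g} i g≡1 = trans
    (sumQ-cong (blockStart i) (ns i) λ t start≤t t<end → trans (cong (ℚ._* ℕ→ℚ (b t)) (g≡1 t start≤t t<end)) (ℚP.*-identityˡ _))
    (sumQ-ℕ→ℚ b (blockStart i) (ns i))

  module Supporting (ns-pos : ∀ t → 1 ℕ.≤ t → t ℕ.≤ r → 1 ℕ.≤ ns t)
                    (b-pos : ∀ l → 1 ℕ.≤ l → l ℕ.≤ n → 1 ℕ.≤ b l) where

    blockWeight-pos : ∀ {i} → 1 ℕ.≤ i → i ℕ.≤ r → 0ℚ ℚ.< ℕ→ℚ (blockWeight i)
    blockWeight-pos {i} 1≤i i≤r = ℕ→ℚ-pos (blockWeight i) (first≤sum (ns i) (ns-pos i 1≤i i≤r))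
      where
      start∈i : InBlock i (blockStart i)
      start∈i = range⇒inBlock 1≤i ℕP.≤-refl (ℕP.m<m+n _ (ns-pos i 1≤i i≤r))
      first≤sum : ∀ k → 1 ℕ.≤ k → 1 ℕ.≤ sumR b (blockStart i) k
      first≤sum (suc k) _ = ℕP.≤-trans (b-pos _ (s≤s z≤n) (inBlock⇒≤n i≤r start∈i)) (ℕP.m≤m+n _ _)

    -- The functional 1 + e_q; each V_{n+1+i} falls short of its value 2 at V_q by at least the weight of block i.
    basis-strictMax : ∀ {q} → 1 ℕ.≤ q → q ℕ.≤ suc n → Σ Pt λ g → StrictMaxAt g q
    basis-strictMax {q} 1≤q q≤n = g , max
      where
      two : ℚ
      two = 1ℚ ℚ.+ 1ℚ
      1<2 : 1ℚ ℚ.< two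
      1<2 = p<p+q 1ℚ 0<1
      g : Pt
      g m = if does (m ℕ.≟ q) then two else 1ℚ
      g≥1 : ∀ m → 1ℚ ℚ.≤ g m
      g≥1 m = if-elim (1ℚ ℚ.≤_) (m ℕ.≟ q) (ℚP.<⇒≤ 1<2) ℚP.≤-refl
      g≤2 : ∀ m → g m ℚ.≤ two
      g≤2 m = if-elim (ℚ._≤ two) (m ℕ.≟ q) ℚP.≤-refl (ℚP.<⇒≤ 1<2)
      gVq≡2 : dot (suc n) g (V r ns b q) ≡ two
      gVq≡2 = trans (dot-V-basis g 1≤q q≤n) (if-yes (q ℕ.≟ q) refl)
      weight≤blockSum : ∀ i → ℕ→ℚ (blockWeight i) ℚ.≤ blockSum g i
      weight≤blockSum i = subst (ℚ._≤ blockSum g i) (blockSum-ones i (λ _ _ _ → refl))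
        (sumQ-mono (blockStart i) (ns i) λ t _ _ → ℚP.*-monoʳ-≤-nonNeg (ℕ→ℚ (b t)) {{ℚ.nonNegative (ℕ→ℚ-nonNeg (b t))}} (g≥1 t))
      max : StrictMaxAt g q
      max q′ q′<count q′≢q with vertexIndex q′ q′<count
      ... | origin = subst₂ ℚ._<_ (sym (dot-V-origin g)) (sym gVq≡2) (ℚP.<-trans 0<1 1<2)
      ... | basis 1≤q′ q′≤n = subst₂ ℚ._<_ (sym (trans (dot-V-basis g 1≤q′ q′≤n) (if-no (q′ ℕ.≟ q) q′≢q))) (sym gVq≡2) 1<2
      ... | hub {i} 1≤i i≤r = begin-strict
        dot (suc n) g (V r ns b (suc n ℕ.+ i)) ≡⟨ dot-V-hub g 1≤i i≤r ⟩
        g (suc n) ℚ.- blockSum g i             ≤⟨ ℚP.+-mono-≤ (g≤2 (suc n)) (ℚP.neg-antimono-≤ (weight≤blockSum i)) ⟩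
        two ℚ.- ℕ→ℚ (blockWeight i)           <⟨ p-q<p two (blockWeight-pos 1≤i i≤r) ⟩
        two                                    ≡⟨ sym gVq≡2 ⟩
        dot (suc n) g (V r ns b q)             ∎
        where open ℚP.≤-Reasoning

    -- The functional e_{n+1} minus the indicator of block j; blocks are disjoint, so it is 1 at every other V_{n+1+i}.
    hub-strictMax : ∀ {j} → 1 ℕ.≤ j → j ℕ.≤ r → Σ Pt λ g → StrictMaxAt g (suc n ℕ.+ j)
    hub-strictMax {j} 1≤j j≤r = g , max
      where
      g : Pt
      g m = if does (m ℕ.≟ suc n) then 1ℚ else if does (inBlock? j m) then ℚ.- 1ℚ else 0ℚ
      g≤1 : ∀ m → g m ℚ.≤ 1ℚ
      g≤1 m = if-elim (ℚ._≤ 1ℚ) (m ℕ.≟ suc n) ℚP.≤-refl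
                (if-elim (ℚ._≤ 1ℚ) (inBlock? j m) (ℚP.<⇒≤ (ℚP.<-trans (ℚP.neg-antimono-< 0<1) 0<1)) (ℚP.<⇒≤ 0<1))
      g-off-top : ∀ {i t} → i ℕ.≤ r → InBlock i t → g t ≡ (if does (inBlock? j t) then ℚ.- 1ℚ else 0ℚ)
      g-off-top i≤r t∈i = if-no (_ ℕ.≟ suc n) (≤n⇒≢suc (inBlock⇒≤n i≤r t∈i))
      weight : ℚ
      weight = ℕ→ℚ (blockWeight j)
      gVj : dot (suc n) g (V r ns b (suc n ℕ.+ j)) ≡ 1ℚ ℚ.+ weight
      gVj = begin
        dot (suc n) g (V r ns b (suc n ℕ.+ j)) ≡⟨ dot-V-hub g 1≤j j≤r ⟩
        g (suc n) ℚ.- blockSum g j             ≡⟨ cong₂ ℚ._-_ (if-yes (suc n ℕ.≟ suc n) refl) blockSum-g ⟩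
        1ℚ ℚ.- ℚ.- weight                     ≡⟨ solve 1 (λ w → con 1ℚ :- (:- w) := con 1ℚ :+ w) refl weight ⟩
        1ℚ ℚ.+ weight                          ∎
        where
        open ≡-Reasoning
        blockSum-g : blockSum g j ≡ ℚ.- weight
        blockSum-g = begin
          blockSum g j                                                   ≡⟨ sumQ-cong (blockStart j) (ns j) (λ t start≤t t<end →
                                                                              let t∈j = range⇒inBlock 1≤j start≤t t<end in
                                                                              trans (cong (ℚ._* ℕ→ℚ (b t)) (trans (g-off-top j≤r t∈j) (if-yes (inBlock? j t) t∈j)))
                                                                                    (sym (ℚP.neg-distribˡ-* 1ℚ (ℕ→ℚ (b t))))) ⟩
          sumQ (λ t → ℚ.- (1ℚ ℚ.* ℕ→ℚ (b t))) (blockStart j) (ns j)     ≡⟨ sumQ-neg _ (blockStart j) (ns j) ⟩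
          ℚ.- blockSum (λ _ → 1ℚ) j                                      ≡⟨ cong ℚ.-_ (blockSum-ones j (λ _ _ _ → refl)) ⟩
          ℚ.- weight                                                     ∎
      1<1+weight : 1ℚ ℚ.< 1ℚ ℚ.+ weight
      1<1+weight = p<p+q 1ℚ (blockWeight-pos 1≤j j≤r)
      max : StrictMaxAt g (suc n ℕ.+ j)
      max q′ q′<count q′≢hub with vertexIndex q′ q′<count
      ... | origin = subst₂ ℚ._<_ (sym (dot-V-origin g)) (sym gVj) (ℚP.<-trans 0<1 1<1+weight)
      ... | basis 1≤q′ q′≤n = subst₂ ℚ._<_ (sym (dot-V-basis g 1≤q′ q′≤n)) (sym gVj) (ℚP.≤-<-trans (g≤1 q′) 1<1+weight)
      ... | hub {i} 1≤i i≤r = subst₂ ℚ._<_ (sym gVi) (sym gVj) 1<1+weight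
        where
        g-off-block-j : ∀ t → blockStart i ℕ.≤ t → t ℕ.< blockStart i ℕ.+ ns i → g t ℚ.* ℕ→ℚ (b t) ≡ 0ℚ
        g-off-block-j t start≤t t<end =
          let t∈i = range⇒inBlock 1≤i start≤t t<end in
          trans (cong (ℚ._* ℕ→ℚ (b t)) (trans (g-off-top i≤r t∈i)
                  (if-no (inBlock? j t) λ t∈j → q′≢hub (cong (suc n ℕ.+_) (inBlock-unique t∈i t∈j)))))
                (ℚP.*-zeroˡ (ℕ→ℚ (b t)))
        gVi : dot (suc n) g (V r ns b (suc n ℕ.+ i)) ≡ 1ℚ
        gVi = trans (dot-V-hub g 1≤i i≤r)
                (trans (cong₂ ℚ._-_ (if-yes (suc n ℕ.≟ suc n) refl) (sumQ-zero (blockStart i) (ns i) g-off-block-j))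
                       (ℚP.+-identityʳ 1ℚ))

    V-extreme : ∀ {q} → 1 ℕ.≤ q → q ℕ.< vertexCount → (Q : Pt → Set) → (∀ x → Q x → InΔ r ns b x) →
                Q (V r ns b q) → IsExtreme (suc n) Q (V r ns b q)
    V-extreme {q} 1≤q q<count Q Q⊆Δ =
      let g , max = supporting (vertexIndex q q<count) in
      strictMax⇒extreme {g} q<count max Q (λ x Qx → Δ⇒hull (Q⊆Δ x Qx))
      where
      supporting : VertexIndex q → Σ Pt λ g → StrictMaxAt g q
      supporting origin              = ⊥-elim (ℕP.<-irrefl refl 1≤q)
      supporting (basis 1≤q′ q′≤n)   = basis-strictMax 1≤q′ q′≤n
      supporting (hub 1≤i i≤r)       = hub-strictMax 1≤i i≤r

  hub-equation : ∀ (c : Pt) {j i} → 1 ℕ.≤ j → j ℕ.≤ r → InBlock j i → 1 ℕ.≤ b i → c (suc n) ≡ 1ℚ →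
    (∀ t → InBlock j t → t ≢ i → c t ≡ 1ℚ) →
    c i ≡ ℚ.- frac (+ blockWeight j ℤ.- + b i) (b i) →
    dot (suc n) c (V r ns b (suc n ℕ.+ j)) ≡ 1ℚ
  hub-equation c {j} {i} 1≤j j≤r i∈j 1≤bᵢ c-top c-block cᵢ = begin
    dot (suc n) c (V r ns b (suc n ℕ.+ j)) ≡⟨ dot-V-hub c 1≤j j≤r ⟩
    c (suc n) ℚ.- blockSum c j             ≡⟨ cong₂ ℚ._-_ c-top blockSum-c ⟩
    1ℚ ℚ.- 0ℚ                              ≡⟨ ℚP.+-identityʳ 1ℚ ⟩
    1ℚ                                     ∎
    where
    open ≡-Reasoning
    W bᵢ : ℚ
    W  = ℕ→ℚ (blockWeight j)
    bᵢ = ℕ→ℚ (b i)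
    F : ℚ
    F = frac (+ blockWeight j ℤ.- + b i) (b i)
    cᵢbᵢ : c i ℚ.* bᵢ ≡ ℚ.- (W ℚ.- bᵢ)
    cᵢbᵢ = begin
      c i ℚ.* bᵢ        ≡⟨ cong (ℚ._* bᵢ) cᵢ ⟩
      ℚ.- F ℚ.* bᵢ      ≡⟨ sym (ℚP.neg-distribˡ-* F bᵢ) ⟩
      ℚ.- (F ℚ.* bᵢ)    ≡⟨ cong ℚ.-_ (trans (frac-*-denominator _ (b i) 1≤bᵢ) (fromℤ-homo-- (+ blockWeight j) (+ b i))) ⟩
      ℚ.- (W ℚ.- bᵢ)    ∎
    i-range : blockStart j ℕ.≤ i × i ℕ.< blockStart j ℕ.+ ns j
    i-range = inBlock⇒range 1≤j i∈j
    blockSum-c : blockSum c j ≡ 0ℚ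
    blockSum-c = begin
      blockSum c j
        ≡⟨ sumQ-except (blockStart j) (ns j) i (proj₁ i-range) (proj₂ i-range)
             (λ t start≤t t<end t≢i → cong (ℚ._* ℕ→ℚ (b t)) (c-block t (range⇒inBlock 1≤j start≤t t<end) t≢i)) ⟩
      blockSum (λ _ → 1ℚ) j ℚ.+ (c i ℚ.* bᵢ ℚ.- 1ℚ ℚ.* bᵢ)
        ≡⟨ cong₂ (λ u v → u ℚ.+ (v ℚ.- 1ℚ ℚ.* bᵢ)) (blockSum-ones j (λ _ _ _ → refl)) cᵢbᵢ ⟩
      W ℚ.+ (ℚ.- (W ℚ.- bᵢ) ℚ.- 1ℚ ℚ.* bᵢ)
        ≡⟨ solve 2 (λ W b → W :+ (:- (W :- b) :- con 1ℚ :* b) := con 0ℚ) refl W bᵢ ⟩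
      0ℚ ∎

-- The facet δ

module FacetVertices (r : ℕ) (ns b : ℕ → ℕ) (b-pos : ∀ l → 1 ℕ.≤ l → l ℕ.≤ N ns r → 1 ℕ.≤ b l)
  (k : ℕ) (i j : ℕ → ℕ)
  (j-range : ∀ l → 1 ℕ.≤ l → l ℕ.≤ k → 1 ℕ.≤ j l × j l ℕ.≤ r)
  (j-injective : ∀ l l′ → 1 ℕ.≤ l → l ℕ.≤ k → 1 ℕ.≤ l′ → l′ ℕ.≤ k → l ≢ l′ → j l ≢ j l′)
  (i∈block : ∀ l → 1 ℕ.≤ l → l ℕ.≤ k → suc (N ns (j l ∸ 1)) ℕ.≤ i l × i l ℕ.≤ N ns (j l))
  (c : Pt)
  (c≡1 : ∀ m → 1 ℕ.≤ m → m ℕ.≤ suc (N ns r) → (∀ l → 1 ℕ.≤ l → l ℕ.≤ k → m ≢ i l) → c m ≡ 1ℚ)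
  (cᵢ : ∀ l → 1 ℕ.≤ l → l ℕ.≤ k →
        c (i l) ≡ ℚ.- frac (+ sumR b (suc (N ns (j l ∸ 1))) (ns (j l)) ℤ.- + b (i l)) (b (i l)))
  where

  open Polytope r ns b

  i≤n : ∀ l → 1 ℕ.≤ l → l ℕ.≤ k → i l ℕ.≤ n
  i≤n l 1≤l l≤k = inBlock⇒≤n (proj₂ (j-range l 1≤l l≤k)) (i∈block l 1≤l l≤k)

  c-top : c (suc n) ≡ 1ℚ
  c-top = c≡1 (suc n) (s≤s z≤n) ℕP.≤-refl λ l 1≤l l≤k top≡i → ≤n⇒≢suc (i≤n l 1≤l l≤k) (sym top≡i)

  c-on-δ-vertices : ∀ q → InS r ns k i j q → dot (suc n) c (V r ns b q) ≡ 1ℚ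
  c-on-δ-vertices _ (inj₁ refl) = trans (dot-V-basis c (s≤s z≤n) ℕP.≤-refl) c-top
  c-on-δ-vertices q (inj₂ (inj₁ (1≤q , q≤n , q∉I))) =
    trans (dot-V-basis c 1≤q (ℕP.m≤n⇒m≤1+n q≤n)) (c≡1 q 1≤q (ℕP.m≤n⇒m≤1+n q≤n) q∉I)
  c-on-δ-vertices _ (inj₂ (inj₂ (l , 1≤l , l≤k , refl))) =
    hub-equation c 1≤jₗ jₗ≤r (i∈block l 1≤l l≤k) (b-pos (i l) 1≤iₗ (i≤n l 1≤l l≤k)) c-top c-block (cᵢ l 1≤l l≤k)
    where
    1≤jₗ : 1 ℕ.≤ j l
    1≤jₗ = proj₁ (j-range l 1≤l l≤k)
    jₗ≤r : j l ℕ.≤ r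
    jₗ≤r = proj₂ (j-range l 1≤l l≤k)
    1≤iₗ : 1 ℕ.≤ i l
    1≤iₗ = ℕP.≤-trans (s≤s z≤n) (proj₁ (i∈block l 1≤l l≤k))
    -- i_l is the only index i_{l′} in block j_l, because the j_{l′} are distinct and blocks are disjoint.
    c-block : ∀ t → InBlock (j l) t → t ≢ i l → c t ≡ 1ℚ
    c-block t t∈jₗ t≢iₗ = c≡1 t (ℕP.≤-trans (s≤s z≤n) (proj₁ t∈jₗ)) (ℕP.m≤n⇒m≤1+n (inBlock⇒≤n jₗ≤r t∈jₗ))
      λ { l′ 1≤l′ l′≤k refl → t≢iₗ (cong i (sym (l≡l′ l′ 1≤l′ l′≤k (inBlock-unique t∈jₗ (i∈block l′ 1≤l′ l′≤k))))) }
      where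
      l≡l′ : ∀ l′ → 1 ℕ.≤ l′ → l′ ℕ.≤ k → j l ≡ j l′ → l ≡ l′
      l≡l′ l′ 1≤l′ l′≤k jₗ≡jₗ′ with l ℕ.≟ l′
      ... | yes l≡l′ = l≡l′
      ... | no l≢l′  = ⊥-elim (j-injective l l′ 1≤l l≤k 1≤l′ l′≤k l≢l′ jₗ≡jₗ′)

proposition3p4 :
    (r : ℕ) → 1 ℕ.≤ r →
    (ns : ℕ → ℕ) → (∀ t → 1 ℕ.≤ t → t ℕ.≤ r → 1 ℕ.≤ ns t) →
    (b : ℕ → ℕ) → (∀ l → 1 ℕ.≤ l → l ℕ.≤ N ns r → 1 ℕ.≤ b l) →
    (k : ℕ) → k ℕ.≤ r → (i j : ℕ → ℕ) →
    (∀ l → 1 ℕ.≤ l → l ℕ.≤ k → 1 ℕ.≤ j l × j l ℕ.≤ r) →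
    (∀ l l′ → 1 ℕ.≤ l → l ℕ.≤ k → 1 ℕ.≤ l′ → l′ ℕ.≤ k → l ≢ l′ → j l ≢ j l′) →
    (∀ l → 1 ℕ.≤ l → l ℕ.≤ k →
       suc (N ns (j l ∸ 1)) ℕ.≤ i l × i l ℕ.≤ N ns (j l)) →
    (a : Pt) (β : ℚ) → IsFacet r ns b a β →
    ¬ InFace r ns b a β (λ _ → 0ℚ) →
    (∀ x → IsExtreme (suc (N ns r)) (InFace r ns b a β) x ⇔
           (∃ λ q → InS r ns k i j q × x ≐[ suc (N ns r) ] V r ns b q)) →
    (c : Pt) →
    (∀ m → 1 ℕ.≤ m → m ℕ.≤ suc (N ns r) → (∀ l → 1 ℕ.≤ l → l ℕ.≤ k → m ≢ i l) →
       c m ≡ 1ℚ) →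
    (∀ l → 1 ℕ.≤ l → l ℕ.≤ k →
       c (i l) ≡ ℚ.- frac (+ sumR b (suc (N ns (j l ∸ 1))) (ns (j l)) ℤ.- + b (i l)) (b (i l))) →
    ∀ x → InFace r ns b a β x → dot (suc (N ns r)) c x ≡ 1ℚ
proposition3p4 r _ ns ns-pos b b-pos k _ i j j-range j-injective i∈block a β (_ , a≤β , _) 0∉face vertices c c≡1 cᵢ
               x (x∈Δ , ax≡β) =
  hull-face-equation a β c 1ℚ (λ q q<count → a≤β _ (V∈Δ q q<count)) c-on-face-vertex (Δ⇒hull x∈Δ) ax≡β
  where
  open Polytope r ns b
  open Supporting ns-pos b-pos
  open FacetVertices r ns b b-pos k i j j-range j-injective i∈block c c≡1 cᵢ

  c-on-face-vertex : ∀ q → q ℕ.< vertexCount → dot (suc n) a (V r ns b q) ≡ β → dot (suc n) c (V r ns b q) ≡ 1ℚ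
  c-on-face-vertex zero    q<count aV≡β = ⊥-elim (0∉face (V∈Δ 0 q<count , aV≡β))
  c-on-face-vertex (suc q) q<count aV≡β =
    let Vq∈face = V∈Δ (suc q) q<count , aV≡β
        q′ , q′∈δ , Vq≐Vq′ = Equivalence.to (vertices _) (V-extreme (s≤s z≤n) q<count _ (λ _ → proj₁) Vq∈face)
    in trans (dot-cong (suc n) c Vq≐Vq′) (c-on-δ-vertices q′ q′∈δ)
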